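{- Let $\Gamma=(V,E,o,t)$ be a connected finite graph with finite modulus $\rho\colon I\to V$. Then $\iota_{\mathfrak m}\colon\mathrm{Cl}^0_{\mathfrak m}(\Gamma)\to\widehat{\mathrm{Cl}}{}^0_{\mathfrak m}(\Gamma)$, $\mathrm{AJ}_{\mathfrak m}\colon\mathrm{Cl}^0_{\mathfrak m}(\Gamma)\to\mathrm{J}_{\mathfrak m}(\Gamma)$, $\zeta_{\mathfrak m}\colon\mathrm{J}_{\mathfrak m}(\Gamma)\to\mathrm{P}_{\mathfrak m}(\Gamma)$ and $\chi_{\mathfrak m}\colon\mathrm{P}_{\mathfrak m}(\Gamma)\to\widehat{\mathrm{Cl}}{}^0_{\mathfrak m}(\Gamma)$ are all isomorphisms, and $\chi_{\mathfrak m}\circ\zeta_{\mathfrak m}\circ\mathrm{AJ}_{\mathfrak m}=\iota_{\mathfrak m}$.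
   Context: Graph: $V\ne\emptyset$, $E$, $o,t\colon E\to V$; finite and connected. Modulus: nonempty finite family $(w_i)_{i\in I}$, $\rho(i)=w_i$, $I(v)=\rho^{ -1}(v)$. $\partial=t-o$, $H_1(\Gamma)=\ker\partial$, $\partial^*v=\sum_{t(e)=v}e-\sum_{o(e)=v}e$, $\Delta_0=\partial\partial^*$; $(df)(e)=f(t(e))-f(o(e))$, $(d^*\omega)(v)=\sum_{t(e)=v}\omega(e)-\sum_{o(e)=v}\omega(e)$, $\square_0=d^*d$, $\mathcal{H}^1(\Gamma)=\ker d^*$. $\mathrm{Cl}^0_{\mathfrak m}=(\mathbb{Z}[V]_0\oplus\mathbb{Z}[I])/\{(\Delta_0x,\rho^*x)\}$ where $\rho^*v=\sum_{i\in I(v)}i$; $\widehat{\mathrm{Cl}}{}^0_{\mathfrak m}=(\operatorname{im}d^*\oplus\mathbb{Z}^I)/\{(\square_0f,f\circ\rho):f\in\mathbb{Z}^V\}$; $\iota_{\mathfrak m}$ is induced by sending vertices and elements of $I$ to their characteristic functions. Extended graph $\Gamma_{\mathfrak m}$: add a vertex $\star$ and edges $e_i$, $o(e_i)=\star$, $t(e_i)=w_i$; $C_1(\Gamma_{\mathfrak m})=\mathbb{Z}[E]\oplus\mathbb{Z}[I]$, $C^1(\Gamma_{\mathfrak m})=\mathbb{Z}^E\oplus\mathbb{Z}^I$, $d_{\mathfrak m}(f,a)=(df,f\circ\rho-a)$ on $\mathbb{Z}^V\oplus\mathbb{Z}$, $H^1(\Gamma_{\mathfrak m})=\operatorname{coker}d_{\mathfrak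 m}\cong\mathrm{Hom}(H_1(\Gamma_{\mathfrak m}),\mathbb{Z})$; $\mathcal{H}^1(\Gamma_{\mathfrak m})=\{(f,g):d^*f+r^*g=0,\ \sum_ig(i)=0\}$ with $(r^*g)(v)=\sum_{i\in I(v)}g(i)$. $\iota$ sends a 1-chain of $\Gamma_{\mathfrak m}$ to the cochain given by its coefficients; it maps $H_1(\Gamma_{\mathfrak m})$ into $\mathcal{H}^1(\Gamma_{\mathfrak m})$. $M^\vee=\mathrm{Hom}(M,\mathbb{Z})$. $\alpha_{\mathfrak m}\colon H_1(\Gamma)\to\mathcal{H}^1(\Gamma_{\mathfrak m})^\vee$, $\gamma\mapsto((f,g)\mapsto f(\gamma))$; $\mathrm{J}_{\mathfrak m}=\mathcal{H}^1(\Gamma_{\mathfrak m})^\vee/\alpha_{\mathfrak m}(H_1(\Gamma))$. $\beta_{\mathfrak m}\colon\mathcal{H}^1(\Gamma)\to H^1(\Gamma_{\mathfrak m})$, $\omega\mapsto[(\omega,0)]$; $\mathrm{P}_{\mathfrak m}=H^1(\Gamma_{\mathfrak m})/\beta_{\mathfrak m}(\mathcal{H}^1(\Gamma))$. $\mathrm{AJ}_{\mathfrak m}$ sends the class of $(\partial\gamma,0)$ to the class of $(f,g)\mapsto f(\gamma)$ and of $(0,i)$ to the class of $(f,g)\mapsto g(i)$. $\zeta_{\mathfrak m}$ is induced by the transpose $\mathcal{H}^1(\Gamma_{\mathfrak m})^\vee\to\mathrm{Hom}(H_1(\Gamma_{\mathfrak m}),\mathbb{Z})=H^1(\Gamma_{\mathfrak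 m})$ of $\iota|_{H_1(\Gamma_{\mathfrak m})}$ (which maps $\alpha_{\mathfrak m}(H_1(\Gamma))$ into $\beta_{\mathfrak m}(\mathcal{H}^1(\Gamma))$). $\chi_{\mathfrak m}$ is induced by $d^*\oplus\mathrm{id}\colon\mathbb{Z}^E\oplus\mathbb{Z}^I\to\operatorname{im}d^*\oplus\mathbb{Z}^I$. -}

module Defs where

open import Data.Nat using (ℕ; zero; suc)
open import Data.Integer using (ℤ; _+_; _-_; _*_; -_; 0ℤ)
open import Data.Fin using (Fin; zero; suc; _≟_)
open import Data.Bool using (if_then_else_)
open import Data.Product using (Σ; ∃; _×_; _,_; proj₁; proj₂)
open import Data.Sum using (_⊎_)
open import Data.Unit using (⊤)
open import Relation.Nullary using (does)
open import Relation.Binary.PropositionalEquality using (_≡_)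
open import Relation.Binary.Construct.Closure.ReflexiveTransitive using (Star)

record Graph : Set where
  field
    nV : ℕ
    nE : ℕ
    o  : Fin nE → Fin nV
    t  : Fin nE → Fin nV

record Modulus (Γ : Graph) : Set where
  field
    nI : ℕ
    ρ  : Fin nI → Fin (Graph.nV Γ)

Adj : (Γ : Graph) → Fin (Graph.nV Γ) → Fin (Graph.nV Γ) → Set
Adj Γ v w = ∃ λ e → (o e ≡ v × t e ≡ w) ⊎ (o e ≡ w × t e ≡ v)
  where open Graph Γ

Connected : Graph → Set
Connected Γ = ∀ v w → Star (Adj Γ) v w

sumFin : ∀ {n} → (Fin n → ℤ) → ℤ
sumFin {zero}  f = 0ℤ
sumFin {suc n} f = f zero + sumFin (λ i → f (suc i))

sel : ∀ {n} → Fin n → Fin n → ℤ → ℤ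
sel v w a = if does (v ≟ w) then a else 0ℤ

-- Abelian groups presented as subquotients: a carrier with addition,
-- a subgroup predicate `Good` (the group of elements considered), and
-- the congruence `_≈_` (difference lies in the subgroup divided out).

record SQ : Set₁ where
  field
    Carrier : Set
    _⊕_     : Carrier → Carrier → Carrier
    Good    : Carrier → Set
    _≈_     : Carrier → Carrier → Set

record IsIso (A B : SQ) (f : SQ.Carrier A → SQ.Carrier B) : Set where
  private
    module A = SQ A
    module B = SQ B
  field
    pres : ∀ a → A.Good a → B.Good (f a)
    resp : ∀ a a' → A.Good a → A.Good a' → A._≈_ a a' → B._≈_ (f a) (f a')
    hom  : ∀ a a' → A.Good a → A.Good a' → B._≈_ (f (A._⊕_ a a')) (B._⊕_ (f a) (f a'))
    inj  : ∀ a a' → A.Good a → A.Good a' → B._≈_ (f a) (f a') → A._≈_ a a'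
    surj : ∀ b → B.Good b → Σ A.Carrier λ a → A.Good a × B._≈_ (f a) b

module Constructions (Γ : Graph) (μ : Modulus Γ) where
  open Graph Γ
  open Modulus μ

  V E I : Set
  V = Fin nV
  E = Fin nE
  I = Fin nI

  -- ℤ[X] and ℤ^X are both represented by functions X → ℤ
  -- (coefficients, resp. values)

  _⊕²_ : ((E → ℤ) × (I → ℤ)) → ((E → ℤ) × (I → ℤ)) → ((E → ℤ) × (I → ℤ))
  (a , b) ⊕² (a' , b') = (λ e → a e + a' e) , (λ i → b i + b' i)

  ∂ : (E → ℤ) → (V → ℤ)
  ∂ γ v = sumFin (λ e → sel (t e) v (γ e)) - sumFin (λ e → sel (o e) v (γ e))

  -- ∂* : ℤ[V] → ℤ[E],  ∂* v = Σ_{t e = v} e - Σ_{o e = v} e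
  ∂* : (V → ℤ) → (E → ℤ)
  ∂* x e = x (t e) - x (o e)

  Δ₀ : (V → ℤ) → (V → ℤ)
  Δ₀ x = ∂ (∂* x)

  -- ρ* : ℤ[V] → ℤ[I],  ρ* v = Σ_{i ∈ I(v)} i
  ρ* : (V → ℤ) → (I → ℤ)
  ρ* x i = x (ρ i)

  deg : (V → ℤ) → ℤ
  deg x = sumFin x

  d : (V → ℤ) → (E → ℤ)
  d f e = f (t e) - f (o e)

  d* : (E → ℤ) → (V → ℤ)
  d* ω v = sumFin (λ e → sel (t e) v (ω e)) - sumFin (λ e → sel (o e) v (ω e))

  □₀ : (V → ℤ) → (V → ℤ)
  □₀ f = d* (d f)

  r* : (I → ℤ) → (V → ℤ)
  r* g v = sumFin (λ i → sel (ρ i) v (g i))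

  ⟨_,_⟩E : (E → ℤ) → (E → ℤ) → ℤ
  ⟨ f , γ ⟩E = sumFin (λ e → f e * γ e)

  ⟨_,_⟩I : (I → ℤ) → (I → ℤ) → ℤ
  ⟨ g , c ⟩I = sumFin (λ i → g i * c i)

  InH₁ : (E → ℤ) → Set
  InH₁ γ = ∀ v → ∂ γ v ≡ 0ℤ

  Inℋ¹ : (E → ℤ) → Set
  Inℋ¹ ω = ∀ v → d* ω v ≡ 0ℤ

  -- Extended graph Γ_𝔪 (extra vertex ⋆, edges e_i : ⋆ → w_i)
  -- C_1(Γ_𝔪) = ℤ[E] ⊕ ℤ[I],  C^1(Γ_𝔪) = ℤ^E ⊕ ℤ^I

  C₁m C¹m : Set
  C₁m = (E → ℤ) × (I → ℤ)
  C¹m = (E → ℤ) × (I → ℤ)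

  ∂mV : C₁m → (V → ℤ)
  ∂mV (γ , c) v = ∂ γ v + sumFin (λ i → sel (ρ i) v (c i))

  ∂m⋆ : C₁m → ℤ
  ∂m⋆ (γ , c) = - sumFin c

  InH₁m : C₁m → Set
  InH₁m z = (∀ v → ∂mV z v ≡ 0ℤ) × (∂m⋆ z ≡ 0ℤ)

  Inℋ¹m : C¹m → Set
  Inℋ¹m (f , g) = (∀ v → d* f v + r* g v ≡ 0ℤ) × (sumFin g ≡ 0ℤ)

  dm : (V → ℤ) × ℤ → C¹m
  dm (f , a) = d f , (λ i → f (ρ i) - a)

  ιm : C₁m → C¹m
  ιm (γ , c) = γ , c

  ⟨_,_⟩m : C¹m → C₁m → ℤ
  ⟨ (f , g) , (γ , c) ⟩m = ⟨ f , γ ⟩E + ⟨ g , c ⟩I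

  Cl : SQ
  Cl = record
    { Carrier = (V → ℤ) × (I → ℤ)
    ; _⊕_ = λ { (x , y) (x' , y') → (λ v → x v + x' v) , (λ i → y i + y' i) }
    ; Good = λ { (x , y) → deg x ≡ 0ℤ }
    ; _≈_ = λ { (x , y) (x' , y') → Σ (V → ℤ) λ z →
                 (∀ v → x v - x' v ≡ Δ₀ z v) × (∀ i → y i - y' i ≡ ρ* z i) }
    }

  ClHat : SQ
  ClHat = record
    { Carrier = (V → ℤ) × (I → ℤ)
    ; _⊕_ = λ { (x , y) (x' , y') → (λ v → x v + x' v) , (λ i → y i + y' i) }
    ; Good = λ { (φ , g) → Σ (E → ℤ) λ ω → ∀ v → d* ω v ≡ φ v }
    ; _≈_ = λ { (φ , g) (φ' , g') → Σ (V → ℤ) λ f →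
                 (∀ v → φ v - φ' v ≡ □₀ f v) × (∀ i → g i - g' i ≡ f (ρ i)) }
    }

  -- J_𝔪 = 𝓗¹(Γ_𝔪)^∨ / α_𝔪(H_1(Γ)).
  -- An element of 𝓗¹(Γ_𝔪)^∨ is represented by a function h : C¹m → ℤ whose
  -- restriction to 𝓗¹(Γ_𝔪) is additive (and respects pointwise equality);
  -- two representatives are identified when their restrictions to
  -- 𝓗¹(Γ_𝔪) differ by α_𝔪(γ) for some γ ∈ H_1(Γ).
  J : SQ
  J = record
    { Carrier = C¹m → ℤ
    ; _⊕_ = λ h h' c → h c + h' c
    ; Good = λ h →
        (∀ c c' → Inℋ¹m c → Inℋ¹m c' → h (c ⊕² c') ≡ h c + h c')
        × (∀ c c' → Inℋ¹m c → Inℋ¹m c' →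
             (∀ e → proj₁ c e ≡ proj₁ c' e) → (∀ i → proj₂ c i ≡ proj₂ c' i) →
             h c ≡ h c')
    ; _≈_ = λ h h' → Σ (E → ℤ) λ γ → InH₁ γ ×
                 (∀ c → Inℋ¹m c → h c ≡ h' c + ⟨ proj₁ c , γ ⟩E)
    }

  -- P_𝔪 = H¹(Γ_𝔪) / β_𝔪(𝓗¹(Γ)),  H¹(Γ_𝔪) = coker d_𝔪,  β_𝔪(ω) = [(ω,0)]
  P : SQ
  P = record
    { Carrier = C¹m
    ; _⊕_ = _⊕²_
    ; Good = λ _ → ⊤
    ; _≈_ = λ { (f , g) (f' , g') → Σ ((V → ℤ) × ℤ) λ ua → Σ (E → ℤ) λ ω →
                 Inℋ¹ ω ×
                 (∀ e → f e - f' e ≡ proj₁ (dm ua) e + ω e) ×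
                 (∀ i → g i - g' i ≡ proj₂ (dm ua) i) }
    }

  -- ι_𝔪 : vertices and elements of I go to their characteristic functions
  ι𝔪 : SQ.Carrier Cl → SQ.Carrier ClHat
  ι𝔪 (x , y) = x , y

  χ𝔪 : SQ.Carrier P → SQ.Carrier ClHat
  χ𝔪 (f , g) = d* f , g

  -- Defining property of (a representative-level lift of) AJ_𝔪:
  -- the class of (∂γ, y) goes to the class of (f,g) ↦ f(γ) + Σ_i g(i) y(i)
  -- (the linear extension of (∂γ,0) ↦ f(γ), (0,i) ↦ g(i)).
  IsAJ : (SQ.Carrier Cl → SQ.Carrier J) → Set
  IsAJ AJ = ∀ x y γ → (∀ v → ∂ γ v ≡ x v) →
    SQ._≈_ J (AJ (x , y)) (λ c → ⟨ proj₁ c , γ ⟩E + ⟨ proj₂ c , y ⟩I)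

  -- Defining property of (a representative-level lift of) ζ_𝔪: under
  -- H¹(Γ_𝔪) ≅ Hom(H_1(Γ_𝔪), ℤ) (cochain ↦ pairing), ζ(h) is the transpose
  -- h ∘ ι|_{H_1(Γ_𝔪)}.
  Isζ : (SQ.Carrier J → SQ.Carrier P) → Set
  Isζ ζ = ∀ h → SQ.Good J h → ∀ z → InH₁m z → h (ιm z) ≡ ⟨ ζ h , z ⟩m

-- A functional on ℋ¹(Γ_𝔪) that is additive on cycles is the pairing with a cochain:
-- fixing a leg e_{i₀} and, by connectivity, a path from ⋆ to every vertex, every cycle
-- of Γ_𝔪 is an integer combination of the resulting fundamental cycles, so the functional
-- is represented by its values on them; and a cochain pairing to zero with all cycles is
-- a coboundary d_𝔪(u, 0), u being its potential along the chosen paths. As 𝓗¹(Γ) = H₁(Γ),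
-- two functionals differ by α_𝔪(H₁(Γ)) exactly when their representing cochains differ
-- by im d_𝔪 + β_𝔪(𝓗¹(Γ)); this makes ζ_𝔪 an isomorphism. χ_𝔪 and ι_𝔪 are isomorphisms
-- since ∂ = d* (the two quotient relations coincide) and im ∂ is the degree-zero part.
-- Finally AJ_𝔪(a) is represented by a cochain F with χ_𝔪 F = ι_𝔪 a, so AJ_𝔪 inherits
-- its properties from χ_𝔪, and the triangle commutes by uniqueness of representing
-- cochains.

module Submission where

open import Defs
open import Data.Nat using (ℕ; zero; suc; _<_)
open import Data.Integer using (ℤ; _+_; _-_; _*_; -_; -[1+_]; 0ℤ; 1ℤ)
open import Data.Integer.Properties
  using (+-identityˡ; +-identityʳ; +-assoc; +-inverseʳ; *-identityˡ; *-identityʳ;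
         *-zeroˡ; *-zeroʳ; *-comm; *-assoc; *-distribˡ-+; *-distribʳ-+;
         neg-distrib-+; neg-distribˡ-*; neg-involutive; i-j≡0⇒i≡j;
         +-commutativeSemigroup; +-0-abelianGroup)
open import Data.Integer.Tactic.RingSolver using (solve-∀)
open import Algebra.Properties.CommutativeSemigroup +-commutativeSemigroup
  using () renaming (interchange to +-interchange)
open import Algebra.Properties.AbelianGroup +-0-abelianGroup
  using (identityˡ-unique; inverseˡ-unique)
open import Data.Fin using (Fin; zero; suc; _≟_; fromℕ<)
open import Data.Bool using (true; false)
open import Data.Product using (Σ; _×_; _,_; proj₁; proj₂)
open import Data.Sum using (inj₁; inj₂)
open import Data.Unit using (tt)
open import Function using (_∘_)
open import Relation.Nullary using (does)
open import Relation.Binary.PropositionalEquality hiding (J)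
open import Relation.Binary.Construct.Closure.ReflexiveTransitive using (Star; ε; _◅_)
open ≡-Reasoning

x≡y+[x-y] : ∀ x y → x ≡ y + (x - y)
x≡y+[x-y] = solve-∀

x≡[x-y]+y : ∀ x y → x ≡ (x - y) + y
x≡[x-y]+y = solve-∀

sumFin-cong : ∀ {n} {f g : Fin n → ℤ} → f ≗ g → sumFin f ≡ sumFin g
sumFin-cong {zero}  f≗g = refl
sumFin-cong {suc n} f≗g = cong₂ _+_ (f≗g zero) (sumFin-cong (f≗g ∘ suc))

sumFin-zero : ∀ {n} {f : Fin n → ℤ} → (∀ i → f i ≡ 0ℤ) → sumFin f ≡ 0ℤ
sumFin-zero {zero}  f≡0 = refl
sumFin-zero {suc n} f≡0 = cong₂ _+_ (f≡0 zero) (sumFin-zero (f≡0 ∘ suc))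

sumFin-+ : ∀ {n} (f g : Fin n → ℤ) → sumFin (λ i → f i + g i) ≡ sumFin f + sumFin g
sumFin-+ {zero}  f g = refl
sumFin-+ {suc n} f g =
  trans (cong (f zero + g zero +_) (sumFin-+ (f ∘ suc) (g ∘ suc)))
        (+-interchange (f zero) (g zero) _ _)

sumFin-neg : ∀ {n} (f : Fin n → ℤ) → sumFin (λ i → - f i) ≡ - sumFin f
sumFin-neg {zero}  f = refl
sumFin-neg {suc n} f =
  trans (cong (- f zero +_) (sumFin-neg (f ∘ suc))) (sym (neg-distrib-+ (f zero) _))

sumFin-*ˡ : ∀ {n} (c : ℤ) (f : Fin n → ℤ) → sumFin (λ i → c * f i) ≡ c * sumFin f
sumFin-*ˡ {zero}  c f = sym (*-zeroʳ c)
sumFin-*ˡ {suc n} c f =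
  trans (cong (c * f zero +_) (sumFin-*ˡ c (f ∘ suc))) (sym (*-distribˡ-+ c (f zero) _))

sumFin-- : ∀ {n} (f g : Fin n → ℤ) → sumFin (λ i → f i - g i) ≡ sumFin f - sumFin g
sumFin-- f g = trans (sumFin-+ f (λ i → - g i)) (cong (sumFin f +_) (sumFin-neg g))

sumFin-*ʳ : ∀ {n} (c : ℤ) (f : Fin n → ℤ) → sumFin (λ i → f i * c) ≡ sumFin f * c
sumFin-*ʳ c f =
  trans (sumFin-cong (λ i → *-comm (f i) c)) (trans (sumFin-*ˡ c f) (*-comm c (sumFin f)))

sumFin-swap : ∀ {m n} (F : Fin m → Fin n → ℤ) →
  sumFin (λ i → sumFin (F i)) ≡ sumFin (λ j → sumFin (λ i → F i j))
sumFin-swap {zero} {n} F = sym (sumFin-zero {n} (λ _ → refl))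
sumFin-swap {suc m} F =
  trans (cong (sumFin (F zero) +_) (sumFin-swap (F ∘ suc)))
        (sym (sumFin-+ (F zero) (λ j → sumFin (λ i → F (suc i) j))))

δ : ∀ {n} → Fin n → Fin n → ℤ
δ a b = sel a b 1ℤ

δ-sym : ∀ {n} (a b : Fin n) → δ a b ≡ δ b a
δ-sym zero    zero    = refl
δ-sym zero    (suc b) = refl
δ-sym (suc a) zero    = refl
δ-sym (suc a) (suc b) = δ-sym a b

sel≡*δ : ∀ {n} (a b : Fin n) x → sel a b x ≡ x * δ a b
sel≡*δ a b x with does (a ≟ b)
... | true  = sym (*-identityʳ x)
... | false = sym (*-zeroʳ x)

dot : ∀ {n} → (Fin n → ℤ) → (Fin n → ℤ) → ℤ
dot f g = sumFin (λ j → f j * g j)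

module _ {n : ℕ} where

  dot-comm : (f g : Fin n → ℤ) → dot f g ≡ dot g f
  dot-comm f g = sumFin-cong (λ j → *-comm (f j) (g j))

  dot-congˡ : ∀ {f f' : Fin n → ℤ} (g : Fin n → ℤ) → f ≗ f' → dot f g ≡ dot f' g
  dot-congˡ g f≗f' = sumFin-cong (λ j → cong (_* g j) (f≗f' j))

  dot-congʳ : ∀ (f : Fin n → ℤ) {g g' : Fin n → ℤ} → g ≗ g' → dot f g ≡ dot f g'
  dot-congʳ f g≗g' = sumFin-cong (λ j → cong (f j *_) (g≗g' j))

  dot-+ˡ : (f f' g : Fin n → ℤ) → dot (λ j → f j + f' j) g ≡ dot f g + dot f' g
  dot-+ˡ f f' g =
    trans (sumFin-cong (λ j → *-distribʳ-+ (g j) (f j) (f' j)))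
          (sumFin-+ (λ j → f j * g j) (λ j → f' j * g j))

  dot-*ˡ : (c : ℤ) (f g : Fin n → ℤ) → dot (λ j → c * f j) g ≡ c * dot f g
  dot-*ˡ c f g = trans (sumFin-cong (λ j → *-assoc c (f j) (g j))) (sumFin-*ˡ c (λ j → f j * g j))

  dot-negˡ : (f g : Fin n → ℤ) → dot (λ j → - f j) g ≡ - dot f g
  dot-negˡ f g =
    trans (sumFin-cong (λ j → sym (neg-distribˡ-* (f j) (g j)))) (sumFin-neg (λ j → f j * g j))

  dot--ˡ : (f f' g : Fin n → ℤ) → dot (λ j → f j - f' j) g ≡ dot f g - dot f' g
  dot--ˡ f f' g = trans (dot-+ˡ f (λ j → - f' j) g) (cong (dot f g +_) (dot-negˡ f' g))

  dot-zeroˡ : ∀ {f : Fin n → ℤ} (g : Fin n → ℤ) → (∀ j → f j ≡ 0ℤ) → dot f g ≡ 0ℤ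
  dot-zeroˡ g f≡0 = sumFin-zero (λ j → trans (cong (_* g j) (f≡0 j)) (*-zeroˡ (g j)))

dot-δʳ : ∀ {n} (f : Fin n → ℤ) (a : Fin n) → dot f (δ a) ≡ f a
dot-δʳ f zero =
  trans (cong₂ _+_ (*-identityʳ (f zero)) (sumFin-zero (λ j → *-zeroʳ (f (suc j)))))
        (+-identityʳ (f zero))
dot-δʳ f (suc a) =
  trans (cong (_+ dot (f ∘ suc) (δ a)) (*-zeroʳ (f zero)))
        (trans (+-identityˡ _) (dot-δʳ (f ∘ suc) a))

dot-δˡ : ∀ {n} (a : Fin n) (f : Fin n → ℤ) → dot (δ a) f ≡ f a
dot-δˡ a f = trans (dot-comm (δ a) f) (dot-δʳ f a)

-- push k γ w sums γ over the fibre k⁻¹(w); definitionally ∂ = d* is push t − push o,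
-- and r* is push ρ.

push : ∀ {m n} → (Fin m → Fin n) → (Fin m → ℤ) → Fin n → ℤ
push k γ w = sumFin (λ j → sel (k j) w (γ j))

module _ {m n : ℕ} (k : Fin m → Fin n) where

  push-dot : ∀ γ w → push k γ w ≡ dot γ (λ j → δ (k j) w)
  push-dot γ w = sumFin-cong (λ j → sel≡*δ (k j) w (γ j))

  push-cong : ∀ {γ γ'} → γ ≗ γ' → ∀ w → push k γ w ≡ push k γ' w
  push-cong γ≗γ' w = sumFin-cong (λ j → cong (sel (k j) w) (γ≗γ' j))

  push-+ : ∀ γ γ' w → push k (λ j → γ j + γ' j) w ≡ push k γ w + push k γ' w
  push-+ γ γ' w = trans (push-dot _ w)
    (trans (dot-+ˡ γ γ' _) (sym (cong₂ _+_ (push-dot γ w) (push-dot γ' w))))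

  push-* : ∀ c γ w → push k (λ j → c * γ j) w ≡ c * push k γ w
  push-* c γ w = trans (push-dot _ w)
    (trans (dot-*ˡ c γ _) (cong (c *_) (sym (push-dot γ w))))

  push-neg : ∀ γ w → push k (λ j → - γ j) w ≡ - push k γ w
  push-neg γ w = trans (push-dot _ w)
    (trans (dot-negˡ γ _) (cong -_ (sym (push-dot γ w))))

  push-zero : ∀ {γ} → (∀ j → γ j ≡ 0ℤ) → ∀ w → push k γ w ≡ 0ℤ
  push-zero γ≡0 w = trans (push-dot _ w) (dot-zeroˡ _ γ≡0)

  push-δ : ∀ a w → push k (δ a) w ≡ δ (k a) w
  push-δ a w = trans (push-dot (δ a) w) (dot-δˡ a _)

  push-adjoint : ∀ γ u → dot (u ∘ k) γ ≡ dot (push k γ) u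
  push-adjoint γ u = sym (begin
    sumFin (λ w → push k γ w * u w)
      ≡⟨ sumFin-cong (λ w → trans (cong (_* u w) (push-dot γ w)) (*-comm _ (u w))) ⟩
    sumFin (λ w → u w * dot γ (λ j → δ (k j) w))
      ≡⟨ sumFin-cong (λ w → sym (sumFin-*ˡ (u w) (λ j → γ j * δ (k j) w))) ⟩
    sumFin (λ w → sumFin (λ j → u w * (γ j * δ (k j) w)))
      ≡⟨ sumFin-swap (λ w j → u w * (γ j * δ (k j) w)) ⟩
    sumFin (λ j → sumFin (λ w → u w * (γ j * δ (k j) w)))
      ≡⟨ sumFin-cong (λ j → sumFin-cong (λ w → rearrange (u w) (γ j) (δ (k j) w))) ⟩
    sumFin (λ j → sumFin (λ w → γ j * (δ (k j) w * u w)))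
      ≡⟨ sumFin-cong (λ j → sumFin-*ˡ (γ j) (λ w → δ (k j) w * u w)) ⟩
    sumFin (λ j → γ j * dot (δ (k j)) u)
      ≡⟨ sumFin-cong (λ j → trans (cong (γ j *_) (dot-δˡ (k j) u)) (*-comm (γ j) _)) ⟩
    dot (u ∘ k) γ ∎)
    where
    rearrange : ∀ x y z → x * (y * z) ≡ y * (z * x)
    rearrange = solve-∀

  push-total : ∀ γ → sumFin (push k γ) ≡ sumFin γ
  push-total γ = begin
    sumFin (push k γ)             ≡⟨ sumFin-cong {n} (λ w → sym (*-identityʳ _)) ⟩
    dot (push k γ) (λ _ → 1ℤ)     ≡⟨ sym (push-adjoint γ (λ _ → 1ℤ)) ⟩
    dot (λ _ → 1ℤ) γ              ≡⟨ sumFin-cong (λ j → *-identityˡ (γ j)) ⟩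
    sumFin γ                      ∎

sumFin-δ : ∀ {n} (a : Fin n) → sumFin (δ a) ≡ 1ℤ
sumFin-δ {n} a = trans (sumFin-cong {n} (λ j → sym (*-identityʳ (δ a j)))) (dot-δˡ a (λ _ → 1ℤ))

_≐_ : {A B : Set} → (A → ℤ) × (B → ℤ) → (A → ℤ) × (B → ℤ) → Set
(f , g) ≐ (f' , g') = f ≗ f' × g ≗ g'

≐-sym : {A B : Set} {a b : (A → ℤ) × (B → ℤ)} → a ≐ b → b ≐ a
≐-sym (f≗f' , g≗g') = (sym ∘ f≗f') , (sym ∘ g≗g')

≐-trans : {A B : Set} {a b c : (A → ℤ) × (B → ℤ)} → a ≐ b → b ≐ c → a ≐ c
≐-trans (f≗f' , g≗g') (f'≗f'' , g'≗g'') =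
  (λ x → trans (f≗f' x) (f'≗f'' x)) , (λ y → trans (g≗g' y) (g'≗g'' y))

module ExtendedGraph (Γ : Graph) (μ : Modulus Γ) where
  open Graph Γ
  open Modulus μ
  open Constructions Γ μ

  ∂-cong : ∀ {γ γ'} → γ ≗ γ' → ∀ v → ∂ γ v ≡ ∂ γ' v
  ∂-cong γ≗γ' v = cong₂ _-_ (push-cong t γ≗γ' v) (push-cong o γ≗γ' v)

  ∂-+ : ∀ γ γ' v → ∂ (λ e → γ e + γ' e) v ≡ ∂ γ v + ∂ γ' v
  ∂-+ γ γ' v = trans (cong₂ _-_ (push-+ t γ γ' v) (push-+ o γ γ' v))
                     (sub-interchange (push t γ v) (push t γ' v) (push o γ v) (push o γ' v))
    where
    sub-interchange : ∀ a b c d → (a + b) - (c + d) ≡ (a - c) + (b - d)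
    sub-interchange = solve-∀

  ∂-neg : ∀ γ v → ∂ (λ e → - γ e) v ≡ - ∂ γ v
  ∂-neg γ v = trans (cong₂ _-_ (push-neg t γ v) (push-neg o γ v))
                    (sym (neg-distrib-+ (push t γ v) (- push o γ v)))

  ∂-- : ∀ γ γ' v → ∂ (λ e → γ e - γ' e) v ≡ ∂ γ v - ∂ γ' v
  ∂-- γ γ' v = trans (∂-+ γ (λ e → - γ' e) v) (cong (∂ γ v +_) (∂-neg γ' v))

  ∂-* : ∀ c γ v → ∂ (λ e → c * γ e) v ≡ c * ∂ γ v
  ∂-* c γ v = trans (cong₂ _-_ (push-* t c γ v) (push-* o c γ v))
                    (factor c (push t γ v) (push o γ v))
    where
    factor : ∀ c a b → c * a - c * b ≡ c * (a - b)
    factor = solve-∀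

  ∂-zero : ∀ {γ} → (∀ e → γ e ≡ 0ℤ) → ∀ v → ∂ γ v ≡ 0ℤ
  ∂-zero γ≡0 v = cong₂ _-_ (push-zero t γ≡0 v) (push-zero o γ≡0 v)

  ∂-δ : ∀ e v → ∂ (δ e) v ≡ δ (t e) v - δ (o e) v
  ∂-δ e v = cong₂ _-_ (push-δ t e v) (push-δ o e v)

  sumFin-∂ : ∀ γ → sumFin (∂ γ) ≡ 0ℤ
  sumFin-∂ γ = begin
    sumFin (∂ γ)                           ≡⟨ sumFin-- (push t γ) (push o γ) ⟩
    sumFin (push t γ) - sumFin (push o γ)  ≡⟨ cong₂ _-_ (push-total t γ) (push-total o γ) ⟩
    sumFin γ - sumFin γ                    ≡⟨ +-inverseʳ (sumFin γ) ⟩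
    0ℤ                                     ∎

  infixl 6 _⊖_
  infixr 7 _·_

  ⊝_ : C¹m → C¹m
  ⊝ (f , g) = (λ e → - f e) , (λ i → - g i)

  _⊖_ : C¹m → C¹m → C¹m
  z ⊖ z' = z ⊕² (⊝ z')

  _·_ : ℤ → C¹m → C¹m
  c · (f , g) = (λ e → c * f e) , (λ i → c * g i)

  𝟎 : C¹m
  𝟎 = (λ _ → 0ℤ) , (λ _ → 0ℤ)

  ∑ : ∀ {n} → (Fin n → ℤ) → (Fin n → C¹m) → C¹m
  ∑ a z = (λ e → sumFin (λ j → a j * proj₁ (z j) e)) , (λ i → sumFin (λ j → a j * proj₂ (z j) i))

  ∂mV-⊕ : ∀ z z' v → ∂mV (z ⊕² z') v ≡ ∂mV z v + ∂mV z' v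
  ∂mV-⊕ (γ , c) (γ' , c') v =
    trans (cong₂ _+_ (∂-+ γ γ' v) (push-+ ρ c c' v))
          (+-interchange (∂ γ v) (∂ γ' v) (push ρ c v) (push ρ c' v))

  ∂mV-⊝ : ∀ z v → ∂mV (⊝ z) v ≡ - ∂mV z v
  ∂mV-⊝ (γ , c) v = trans (cong₂ _+_ (∂-neg γ v) (push-neg ρ c v))
                          (sym (neg-distrib-+ (∂ γ v) (push ρ c v)))

  ∂mV-⊖ : ∀ z z' v → ∂mV (z ⊖ z') v ≡ ∂mV z v - ∂mV z' v
  ∂mV-⊖ z z' v = trans (∂mV-⊕ z (⊝ z') v) (cong (∂mV z v +_) (∂mV-⊝ z' v))

  ∂mV-· : ∀ a z v → ∂mV (a · z) v ≡ a * ∂mV z v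
  ∂mV-· a (γ , c) v = trans (cong₂ _+_ (∂-* a γ v) (push-* ρ a c v))
                            (sym (*-distribˡ-+ a (∂ γ v) (push ρ c v)))

  ∂mV-𝟎 : ∀ v → ∂mV 𝟎 v ≡ 0ℤ
  ∂mV-𝟎 v = cong₂ _+_ (∂-zero (λ _ → refl) v) (push-zero ρ (λ _ → refl) v)

  ∂mV-∑ : ∀ {n} (a : Fin n → ℤ) (z : Fin n → C¹m) v →
    ∂mV (∑ a z) v ≡ sumFin (λ j → a j * ∂mV (z j) v)
  ∂mV-∑ {zero}  a z v = ∂mV-𝟎 v
  ∂mV-∑ {suc n} a z v = begin
    ∂mV ((a zero · z zero) ⊕² ∑ (a ∘ suc) (z ∘ suc)) v
      ≡⟨ ∂mV-⊕ (a zero · z zero) (∑ (a ∘ suc) (z ∘ suc)) v ⟩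
    ∂mV (a zero · z zero) v + ∂mV (∑ (a ∘ suc) (z ∘ suc)) v
      ≡⟨ cong₂ _+_ (∂mV-· (a zero) (z zero) v) (∂mV-∑ (a ∘ suc) (z ∘ suc) v) ⟩
    a zero * ∂mV (z zero) v + sumFin (λ j → a (suc j) * ∂mV (z (suc j)) v) ∎

  sumFin-∑ : ∀ {n} (a : Fin n → ℤ) (z : Fin n → C¹m) →
    sumFin (proj₂ (∑ a z)) ≡ sumFin (λ j → a j * sumFin (proj₂ (z j)))
  sumFin-∑ a z =
    trans (sumFin-swap (λ i j → a j * proj₂ (z j) i))
          (sumFin-cong (λ j → sumFin-*ˡ (a j) (proj₂ (z j))))

  ℋ¹m-𝟎 : Inℋ¹m 𝟎
  ℋ¹m-𝟎 = ∂mV-𝟎 , sumFin-zero {nI} (λ _ → refl)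

  ℋ¹m-⊕ : ∀ {z z'} → Inℋ¹m z → Inℋ¹m z' → Inℋ¹m (z ⊕² z')
  ℋ¹m-⊕ {z} {z'} (∂z≡0 , Σz≡0) (∂z'≡0 , Σz'≡0) =
    (λ v → trans (∂mV-⊕ z z' v) (cong₂ _+_ (∂z≡0 v) (∂z'≡0 v))) ,
    trans (sumFin-+ (proj₂ z) (proj₂ z')) (cong₂ _+_ Σz≡0 Σz'≡0)

  ℋ¹m-· : ∀ a {z} → Inℋ¹m z → Inℋ¹m (a · z)
  ℋ¹m-· a {z} (∂z≡0 , Σz≡0) =
    (λ v → trans (∂mV-· a z v) (trans (cong (a *_) (∂z≡0 v)) (*-zeroʳ a))) ,
    trans (sumFin-*ˡ a (proj₂ z)) (trans (cong (a *_) Σz≡0) (*-zeroʳ a))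

  ℋ¹m-∑ : ∀ {n} (a : Fin n → ℤ) {z : Fin n → C¹m} → (∀ j → Inℋ¹m (z j)) → Inℋ¹m (∑ a z)
  ℋ¹m-∑ a {z} zH =
    (λ v → trans (∂mV-∑ a z v)
                 (sumFin-zero (λ j → trans (cong (a j *_) (proj₁ (zH j) v)) (*-zeroʳ (a j))))) ,
    trans (sumFin-∑ a z)
          (sumFin-zero (λ j → trans (cong (a j *_) (proj₂ (zH j))) (*-zeroʳ (a j))))

  -- ι is the identity on pairs; the cycle condition of Γ_𝔪 and harmonicity differ only in
  -- the sign of the ⋆-component.
  ℋ¹m⇒H₁m : ∀ z → Inℋ¹m z → InH₁m z
  ℋ¹m⇒H₁m z (∂z≡0 , Σz≡0) = ∂z≡0 , cong -_ Σz≡0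

  H₁m⇒ℋ¹m : ∀ z → InH₁m z → Inℋ¹m z
  H₁m⇒ℋ¹m z (∂z≡0 , -Σz≡0) = ∂z≡0 , trans (sym (neg-involutive _)) (cong -_ -Σz≡0)

  pair-comm : ∀ F z → ⟨ F , z ⟩m ≡ ⟨ z , F ⟩m
  pair-comm (f , g) (γ , c) = cong₂ _+_ (dot-comm f γ) (dot-comm g c)

  pair-congˡ : ∀ {F F'} z → F ≐ F' → ⟨ F , z ⟩m ≡ ⟨ F' , z ⟩m
  pair-congˡ (γ , c) (f≗f' , g≗g') = cong₂ _+_ (dot-congˡ γ f≗f') (dot-congˡ c g≗g')

  pair-⊕ˡ : ∀ F F' z → ⟨ F ⊕² F' , z ⟩m ≡ ⟨ F , z ⟩m + ⟨ F' , z ⟩m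
  pair-⊕ˡ (f , g) (f' , g') (γ , c) =
    trans (cong₂ _+_ (dot-+ˡ f f' γ) (dot-+ˡ g g' c))
          (+-interchange (dot f γ) (dot f' γ) (dot g c) (dot g' c))

  pair-⊝ˡ : ∀ F z → ⟨ ⊝ F , z ⟩m ≡ - ⟨ F , z ⟩m
  pair-⊝ˡ (f , g) (γ , c) = trans (cong₂ _+_ (dot-negˡ f γ) (dot-negˡ g c))
                                 (sym (neg-distrib-+ (dot f γ) (dot g c)))

  pair-⊖ˡ : ∀ F F' z → ⟨ F ⊖ F' , z ⟩m ≡ ⟨ F , z ⟩m - ⟨ F' , z ⟩m
  pair-⊖ˡ F F' z = trans (pair-⊕ˡ F (⊝ F') z) (cong (⟨ F , z ⟩m +_) (pair-⊝ˡ F' z))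

  pair-congʳ : ∀ F {z z'} → z ≐ z' → ⟨ F , z ⟩m ≡ ⟨ F , z' ⟩m
  pair-congʳ F {z} {z'} z≐z' =
    trans (pair-comm F z) (trans (pair-congˡ F z≐z') (sym (pair-comm F z')))

  pair-⊕ʳ : ∀ F z z' → ⟨ F , z ⊕² z' ⟩m ≡ ⟨ F , z ⟩m + ⟨ F , z' ⟩m
  pair-⊕ʳ F z z' =
    trans (pair-comm F (z ⊕² z'))
          (trans (pair-⊕ˡ z z' F) (sym (cong₂ _+_ (pair-comm F z) (pair-comm F z'))))

  pair-⊖ʳ : ∀ F z z' → ⟨ F , z ⊖ z' ⟩m ≡ ⟨ F , z ⟩m - ⟨ F , z' ⟩m
  pair-⊖ʳ F z z' =
    trans (pair-comm F (z ⊖ z'))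
          (trans (pair-⊖ˡ z z' F) (sym (cong₂ _-_ (pair-comm F z) (pair-comm F z'))))

  pair-E : ∀ ω z → ⟨ (ω , λ _ → 0ℤ) , z ⟩m ≡ ⟨ proj₁ z , ω ⟩E
  pair-E ω (γ , c) =
    trans (cong (dot ω γ +_) (dot-zeroˡ c (λ _ → refl)))
          (trans (+-identityʳ (dot ω γ)) (dot-comm ω γ))

  pair-dm : ∀ u a z → ⟨ dm (u , a) , z ⟩m ≡ dot (∂mV z) u - a * sumFin (proj₂ z)
  pair-dm u a (γ , c) = begin
    dot (λ e → u (t e) - u (o e)) γ + dot (λ i → u (ρ i) - a) c
      ≡⟨ cong₂ _+_ (dot--ˡ (u ∘ t) (u ∘ o) γ) (dot--ˡ (u ∘ ρ) (λ _ → a) c) ⟩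
    (dot (u ∘ t) γ - dot (u ∘ o) γ) + (dot (u ∘ ρ) c - dot (λ _ → a) c)
      ≡⟨ cong₂ (λ x y → x + (y - dot (λ _ → a) c))
               (cong₂ _-_ (push-adjoint t γ u) (push-adjoint o γ u))
               (push-adjoint ρ c u) ⟩
    (dot (push t γ) u - dot (push o γ) u) + (dot (push ρ c) u - dot (λ _ → a) c)
      ≡⟨ cong₂ (λ x y → x + (dot (push ρ c) u - y))
               (sym (dot--ˡ (push t γ) (push o γ) u)) (sumFin-*ˡ a c) ⟩
    (dot (∂ γ) u + (dot (push ρ c) u - a * sumFin c))
      ≡⟨ sym (+-assoc (dot (∂ γ) u) (dot (push ρ c) u) _) ⟩
    (dot (∂ γ) u + dot (push ρ c) u) - a * sumFin c
      ≡⟨ cong (_- a * sumFin c) (sym (dot-+ˡ (∂ γ) (push ρ c) u)) ⟩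
    dot (∂mV (γ , c)) u - a * sumFin c ∎

  dm⊥ℋ¹m : ∀ u a {z} → Inℋ¹m z → ⟨ dm (u , a) , z ⟩m ≡ 0ℤ
  dm⊥ℋ¹m u a {z} (∂z≡0 , Σz≡0) = begin
    ⟨ dm (u , a) , z ⟩m                 ≡⟨ pair-dm u a z ⟩
    dot (∂mV z) u - a * sumFin (proj₂ z) ≡⟨ cong₂ (λ x y → x - a * y) (dot-zeroˡ u ∂z≡0) Σz≡0 ⟩
    0ℤ - a * 0ℤ                          ≡⟨ cong (λ x → 0ℤ - x) (*-zeroʳ a) ⟩
    0ℤ                                   ∎

  unitE : E → C¹m
  unitE e = δ e , (λ _ → 0ℤ)

  unitI : I → C¹m
  unitI i = (λ _ → 0ℤ) , δ i

  pair-unitE : ∀ G e → ⟨ G , unitE e ⟩m ≡ proj₁ G e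
  pair-unitE (f , g) e =
    trans (cong₂ _+_ (dot-δʳ f e) (sumFin-zero (λ i → *-zeroʳ (g i)))) (+-identityʳ (f e))

  pair-unitI : ∀ G i → ⟨ G , unitI i ⟩m ≡ proj₂ G i
  pair-unitI (f , g) i =
    trans (cong₂ _+_ (sumFin-zero (λ e → *-zeroʳ (f e))) (dot-δʳ g i)) (+-identityˡ (g i))

  ∂mV-unitE : ∀ e w → ∂mV (unitE e) w ≡ δ (t e) w - δ (o e) w
  ∂mV-unitE e w = trans (cong₂ _+_ (∂-δ e w) (push-zero ρ (λ _ → refl) w))
                        (+-identityʳ (δ (t e) w - δ (o e) w))

  ∂mV-unitI : ∀ i w → ∂mV (unitI i) w ≡ δ (ρ i) w
  ∂mV-unitI i w = trans (cong₂ _+_ (∂-zero (λ _ → refl) w) (push-δ ρ i w)) (+-identityˡ (δ (ρ i) w))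

  _≈ᴶ_ : (C¹m → ℤ) → (C¹m → ℤ) → Set
  _≈ᴶ_ = SQ._≈_ J

  _≈ᴾ_ : C¹m → C¹m → Set
  _≈ᴾ_ = SQ._≈_ P

  _≈̂_ : (V → ℤ) × (I → ℤ) → (V → ℤ) × (I → ℤ) → Set
  _≈̂_ = SQ._≈_ ClHat

  ≐⇒≈̂ : ∀ {a b} → a ≐ b → a ≈̂ b
  ≐⇒≈̂ {φ , g} {φ' , g'} (φ≗φ' , g≗g') =
    (λ _ → 0ℤ) ,
    (λ v → trans (cong (_- φ' v) (φ≗φ' v))
                 (trans (+-inverseʳ (φ' v)) (sym (∂-zero (λ _ → refl) v)))) ,
    (λ i → trans (cong (_- g' i) (g≗g' i)) (+-inverseʳ (g' i)))

  ≈̂-respˡ-≐ : ∀ {a a' b} → a ≐ a' → a ≈̂ b → a' ≈̂ b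
  ≈̂-respˡ-≐ {b = ψ , k} (φ≗ , g≗) (f , φ-ψ , g-k) =
    f , (λ v → trans (cong (_- ψ v) (sym (φ≗ v))) (φ-ψ v)) ,
        (λ i → trans (cong (_- k i) (sym (g≗ i))) (g-k i))

  ≈̂-respʳ-≐ : ∀ {a b b'} → b ≐ b' → a ≈̂ b → a ≈̂ b'
  ≈̂-respʳ-≐ {a = φ , g} (ψ≗ , k≗) (f , φ-ψ , g-k) =
    f , (λ v → trans (cong (λ x → φ v - x) (sym (ψ≗ v))) (φ-ψ v)) ,
        (λ i → trans (cong (λ x → g i - x) (sym (k≗ i))) (g-k i))

  χ-resp : ∀ F F' → F ≈ᴾ F' → χ𝔪 F ≈̂ χ𝔪 F'
  χ-resp (f , g) (f' , g') ((u , a) , ω , ∂ω≡0 , f-f' , g-g') =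
    u-a , (λ v → begin
      ∂ f v - ∂ f' v                ≡⟨ sym (∂-- f f' v) ⟩
      ∂ (λ e → f e - f' e) v        ≡⟨ ∂-cong f-f' v ⟩
      ∂ (λ e → d u e + ω e) v       ≡⟨ ∂-+ (d u) ω v ⟩
      ∂ (d u) v + ∂ ω v             ≡⟨ cong (∂ (d u) v +_) (∂ω≡0 v) ⟩
      ∂ (d u) v + 0ℤ                ≡⟨ +-identityʳ _ ⟩
      ∂ (d u) v                     ≡⟨ ∂-cong (λ e → shift (u (t e)) (u (o e)) a) v ⟩
      ∂ (d u-a) v                   ∎) , g-g'
    where
    u-a : V → ℤ
    u-a v = u v - a
    shift : ∀ x y a → x - y ≡ (x - a) - (y - a)
    shift = solve-∀

  χ-inj : ∀ F F' → χ𝔪 F ≈̂ χ𝔪 F' → F ≈ᴾ F'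
  χ-inj (f , g) (f' , g') (u , ∂f-∂f' , g-g') =
    (u , 0ℤ) , ω , ∂ω≡0 , (λ e → x≡y+[x-y] (f e - f' e) (d u e)) ,
    (λ i → trans (g-g' i) (sym (+-identityʳ (u (ρ i)))))
    where
    ω : E → ℤ
    ω e = (f e - f' e) - d u e
    ∂ω≡0 : Inℋ¹ ω
    ∂ω≡0 v = begin
      ∂ ω v                                ≡⟨ ∂-- (λ e → f e - f' e) (d u) v ⟩
      ∂ (λ e → f e - f' e) v - ∂ (d u) v   ≡⟨ cong (_- ∂ (d u) v) (∂-- f f' v) ⟩
      (∂ f v - ∂ f' v) - ∂ (d u) v         ≡⟨ cong (_- ∂ (d u) v) (∂f-∂f' v) ⟩
      ∂ (d u) v - ∂ (d u) v                ≡⟨ +-inverseʳ (∂ (d u) v) ⟩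
      0ℤ                                   ∎

  χ-iso : IsIso P ClHat χ𝔪
  χ-iso = record
    { pres = λ (f , _) _ → f , (λ _ → refl)
    ; resp = λ F F' _ _ → χ-resp F F'
    ; hom  = λ (f , g) (f' , g') _ _ →
        ≐⇒≈̂ {a = χ𝔪 ((f , g) ⊕² (f' , g'))} (∂-+ f f' , (λ _ → refl))
    ; inj  = λ F F' _ _ → χ-inj F F'
    ; surj = λ (φ , g) (ω , ∂ω≡φ) → (ω , g) , tt , ≐⇒≈̂ {b = φ , g} (∂ω≡φ , (λ _ → refl))
    }

  -- A record rather than a Π-type, so that h and F can be inferred from a proof.
  record Represents (h : C¹m → ℤ) (F : C¹m) : Set where
    constructor represents
    field
      eval : ∀ c → Inℋ¹m c → h c ≡ ⟨ F , c ⟩m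
  open Represents

  represents⇒good : ∀ {h F} → Represents h F → SQ.Good J h
  represents⇒good {h} {F} hF = additive , congruent
    where
    additive : ∀ c c' → Inℋ¹m c → Inℋ¹m c' → h (c ⊕² c') ≡ h c + h c'
    additive c c' cH c'H = begin
      h (c ⊕² c')               ≡⟨ eval hF (c ⊕² c') (ℋ¹m-⊕ cH c'H) ⟩
      ⟨ F , c ⊕² c' ⟩m          ≡⟨ pair-⊕ʳ F c c' ⟩
      ⟨ F , c ⟩m + ⟨ F , c' ⟩m  ≡⟨ sym (cong₂ _+_ (eval hF c cH) (eval hF c' c'H)) ⟩
      h c + h c'                ∎
    congruent : ∀ c c' → Inℋ¹m c → Inℋ¹m c' →
      proj₁ c ≗ proj₁ c' → proj₂ c ≗ proj₂ c' → h c ≡ h c'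
    congruent c c' cH c'H p q =
      trans (eval hF c cH) (trans (pair-congʳ F (p , q)) (sym (eval hF c' c'H)))

  pairing-represents : ∀ F → Represents ⟨ F ,_⟩m F
  pairing-represents F = represents λ _ _ → refl

  represents-⊕ : ∀ {h h' F F'} → Represents h F → Represents h' F' →
    Represents (λ c → h c + h' c) (F ⊕² F')
  represents-⊕ {F = F} {F'} hF h'F' = represents λ c cH →
    trans (cong₂ _+_ (eval hF c cH) (eval h'F' c cH)) (sym (pair-⊕ˡ F F' c))

  ≈ᴾ⇒≈ᴶ : ∀ {h h' F F'} → Represents h F → Represents h' F' → F ≈ᴾ F' → h ≈ᴶ h'
  ≈ᴾ⇒≈ᴶ {h} {h'} {F} {F'} hF h'F' ((u , a) , ω , ∂ω≡0 , F-F'₁ , F-F'₂) =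
    ω , ∂ω≡0 , λ c cH → begin
      h c
        ≡⟨ eval hF c cH ⟩
      ⟨ F , c ⟩m
        ≡⟨ x≡y+[x-y] ⟨ F , c ⟩m ⟨ F' , c ⟩m ⟩
      ⟨ F' , c ⟩m + (⟨ F , c ⟩m - ⟨ F' , c ⟩m)
        ≡⟨ cong₂ _+_ (sym (eval h'F' c cH)) (sym (pair-⊖ˡ F F' c)) ⟩
      h' c + ⟨ F ⊖ F' , c ⟩m
        ≡⟨ cong (h' c +_) (pair-congˡ c (F-F'₁ , F-F'₂')) ⟩
      h' c + ⟨ dm (u , a) ⊕² (ω , λ _ → 0ℤ) , c ⟩m
        ≡⟨ cong (h' c +_) (pair-⊕ˡ (dm (u , a)) _ c) ⟩
      h' c + (⟨ dm (u , a) , c ⟩m + ⟨ (ω , λ _ → 0ℤ) , c ⟩m)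
        ≡⟨ cong₂ (λ x y → h' c + (x + y)) (dm⊥ℋ¹m u a cH) (pair-E ω c) ⟩
      h' c + (0ℤ + ⟨ proj₁ c , ω ⟩E)
        ≡⟨ cong (h' c +_) (+-identityˡ _) ⟩
      h' c + ⟨ proj₁ c , ω ⟩E ∎
    where
    F-F'₂' : proj₂ (F ⊖ F') ≗ proj₂ (dm (u , a) ⊕² (ω , λ _ → 0ℤ))
    F-F'₂' i = trans (F-F'₂ i) (sym (+-identityʳ _))

  represents-≈ᴶ : ∀ {h h' F} (h≈h' : h ≈ᴶ h') → Represents h' F →
    Represents h (F ⊕² (proj₁ h≈h' , λ _ → 0ℤ))
  represents-≈ᴶ {h} {h'} {F} (γ , _ , h≡h'+γ) h'F = represents λ c cH → begin
    h c                                              ≡⟨ h≡h'+γ c cH ⟩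
    h' c + ⟨ proj₁ c , γ ⟩E                          ≡⟨ cong₂ _+_ (eval h'F c cH) (sym (pair-E γ c)) ⟩
    ⟨ F , c ⟩m + ⟨ (γ , λ _ → 0ℤ) , c ⟩m             ≡⟨ sym (pair-⊕ˡ F (γ , λ _ → 0ℤ) c) ⟩
    ⟨ F ⊕² (γ , λ _ → 0ℤ) , c ⟩m                     ∎

  ≈ᴶ-refl : ∀ h → h ≈ᴶ h
  ≈ᴶ-refl h = (λ _ → 0ℤ) , ∂-zero (λ _ → refl) ,
    λ c _ → sym (trans (cong (h c +_) (sumFin-zero (λ e → *-zeroʳ (proj₁ c e))))
                       (+-identityʳ (h c)))

  module Rooted (conn : Connected Γ) (i₀ : I) where

    w₀ : V
    w₀ = ρ i₀

    path : ∀ {a b} → Star (Adj Γ) a b → E → ℤ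
    path ε                  _  = 0ℤ
    path ((e , inj₁ _) ◅ p) e' = δ e e' + path p e'
    path ((e , inj₂ _) ◅ p) e' = - δ e e' + path p e'

    ∂-path : ∀ {a b} (p : Star (Adj Γ) a b) v → ∂ (path p) v ≡ δ b v - δ a v
    ∂-path {a} ε v = trans (∂-zero (λ _ → refl) v) (sym (+-inverseʳ (δ a v)))
    ∂-path {b = b} ((e , inj₁ (refl , refl)) ◅ p) v = begin
      ∂ (λ e' → δ e e' + path p e') v                 ≡⟨ ∂-+ (δ e) (path p) v ⟩
      ∂ (δ e) v + ∂ (path p) v                        ≡⟨ cong₂ _+_ (∂-δ e v) (∂-path p v) ⟩
      (δ (t e) v - δ (o e) v) + (δ b v - δ (t e) v)   ≡⟨ telescope (δ (o e) v) (δ (t e) v) (δ b v) ⟩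
      δ b v - δ (o e) v                               ∎
      where
      telescope : ∀ x y z → (y - x) + (z - y) ≡ z - x
      telescope = solve-∀
    ∂-path {b = b} ((e , inj₂ (refl , refl)) ◅ p) v = begin
      ∂ (λ e' → - δ e e' + path p e') v               ≡⟨ ∂-+ (λ e' → - δ e e') (path p) v ⟩
      ∂ (λ e' → - δ e e') v + ∂ (path p) v            ≡⟨ cong (_+ ∂ (path p) v) (∂-neg (δ e) v) ⟩
      - ∂ (δ e) v + ∂ (path p) v                      ≡⟨ cong₂ (λ x y → - x + y) (∂-δ e v) (∂-path p v) ⟩
      - (δ (t e) v - δ (o e) v) + (δ b v - δ (o e) v) ≡⟨ telescope (δ (t e) v) (δ (o e) v) (δ b v) ⟩
      δ b v - δ (t e) v                               ∎
      where
      telescope : ∀ x y z → - (x - y) + (z - y) ≡ z - x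
      telescope = solve-∀

    -- A chain from ⋆ to v: the leg e_{i₀}, then a path from w₀ to v.
    ⋆-path : V → C¹m
    ⋆-path v = path (conn w₀ v) , δ i₀

    ∂mV-⋆-path : ∀ v w → ∂mV (⋆-path v) w ≡ δ v w
    ∂mV-⋆-path v w = trans (cong₂ _+_ (∂-path (conn w₀ v) w) (push-δ ρ i₀ w))
                           (x-y+y≡x (δ v w) (δ w₀ w))
      where
      x-y+y≡x : ∀ x y → (x - y) + y ≡ x
      x-y+y≡x = solve-∀

    cycleE : E → C¹m
    cycleE e = (unitE e ⊕² ⋆-path (o e)) ⊖ ⋆-path (t e)

    cycleI : I → C¹m
    cycleI i = unitI i ⊖ ⋆-path (ρ i)

    ℋ¹m-cycleE : ∀ e → Inℋ¹m (cycleE e)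
    ℋ¹m-cycleE e = ∂≡0 , sumFin-zero (λ i → cancel (δ i₀ i))
      where
      cancel : ∀ x → (0ℤ + x) - x ≡ 0ℤ
      cancel = solve-∀
      telescope : ∀ x y → ((x - y) + y) - x ≡ 0ℤ
      telescope = solve-∀
      ∂≡0 : ∀ w → ∂mV (cycleE e) w ≡ 0ℤ
      ∂≡0 w = begin
        ∂mV (cycleE e) w
          ≡⟨ ∂mV-⊖ (unitE e ⊕² ⋆-path (o e)) (⋆-path (t e)) w ⟩
        ∂mV (unitE e ⊕² ⋆-path (o e)) w - ∂mV (⋆-path (t e)) w
          ≡⟨ cong (_- ∂mV (⋆-path (t e)) w) (∂mV-⊕ (unitE e) (⋆-path (o e)) w) ⟩
        (∂mV (unitE e) w + ∂mV (⋆-path (o e)) w) - ∂mV (⋆-path (t e)) w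
          ≡⟨ cong₂ _-_ (cong₂ _+_ (∂mV-unitE e w) (∂mV-⋆-path (o e) w)) (∂mV-⋆-path (t e) w) ⟩
        ((δ (t e) w - δ (o e) w) + δ (o e) w) - δ (t e) w
          ≡⟨ telescope (δ (t e) w) (δ (o e) w) ⟩
        0ℤ ∎

    ℋ¹m-cycleI : ∀ i → Inℋ¹m (cycleI i)
    ℋ¹m-cycleI i =
      (λ w → begin
        ∂mV (cycleI i) w                         ≡⟨ ∂mV-⊖ (unitI i) (⋆-path (ρ i)) w ⟩
        ∂mV (unitI i) w - ∂mV (⋆-path (ρ i)) w   ≡⟨ cong₂ _-_ (∂mV-unitI i w) (∂mV-⋆-path (ρ i) w) ⟩
        δ (ρ i) w - δ (ρ i) w                    ≡⟨ +-inverseʳ (δ (ρ i) w) ⟩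
        0ℤ                                       ∎) ,
      (begin
        sumFin (λ i' → δ i i' - δ i₀ i')         ≡⟨ sumFin-- (δ i) (δ i₀) ⟩
        sumFin (δ i) - sumFin (δ i₀)             ≡⟨ cong₂ _-_ (sumFin-δ i) (sumFin-δ i₀) ⟩
        0ℤ                                       ∎)

    potential : C¹m → V → ℤ
    potential G v = ⟨ G , ⋆-path v ⟩m

    ⊥ℋ¹m⇒exact : ∀ G → (∀ z → Inℋ¹m z → ⟨ G , z ⟩m ≡ 0ℤ) → G ≐ dm (potential G , 0ℤ)
    ⊥ℋ¹m⇒exact G G⊥ = edge , leg
      where
      u : V → ℤ
      u = potential G
      solve-for : ∀ x y z → (x + y) - z ≡ 0ℤ → x ≡ z - y
      solve-for x y z x+y-z≡0 =
        trans (x≡x+y-y x y) (cong (_- y) (i-j≡0⇒i≡j (x + y) z x+y-z≡0))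
        where
        x≡x+y-y : ∀ x y → x ≡ (x + y) - y
        x≡x+y-y = solve-∀
      edge : ∀ e → proj₁ G e ≡ u (t e) - u (o e)
      edge e = solve-for (proj₁ G e) (u (o e)) (u (t e)) (begin
        (proj₁ G e + u (o e)) - u (t e)
          ≡⟨ cong (λ x → (x + u (o e)) - u (t e)) (sym (pair-unitE G e)) ⟩
        (⟨ G , unitE e ⟩m + u (o e)) - u (t e)
          ≡⟨ cong (_- u (t e)) (sym (pair-⊕ʳ G (unitE e) (⋆-path (o e)))) ⟩
        ⟨ G , unitE e ⊕² ⋆-path (o e) ⟩m - u (t e)
          ≡⟨ sym (pair-⊖ʳ G (unitE e ⊕² ⋆-path (o e)) (⋆-path (t e))) ⟩
        ⟨ G , cycleE e ⟩m
          ≡⟨ G⊥ (cycleE e) (ℋ¹m-cycleE e) ⟩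
        0ℤ ∎)
      leg : ∀ i → proj₂ G i ≡ u (ρ i) - 0ℤ
      leg i = trans (i-j≡0⇒i≡j (proj₂ G i) (u (ρ i)) (begin
        proj₂ G i - u (ρ i)               ≡⟨ cong (_- u (ρ i)) (sym (pair-unitI G i)) ⟩
        ⟨ G , unitI i ⟩m - u (ρ i)        ≡⟨ sym (pair-⊖ʳ G (unitI i) (⋆-path (ρ i))) ⟩
        ⟨ G , cycleI i ⟩m                 ≡⟨ G⊥ (cycleI i) (ℋ¹m-cycleI i) ⟩
        0ℤ                                ∎)) (sym (+-identityʳ (u (ρ i))))

    pair-⊖dm : ∀ {z} → Inℋ¹m z → ∀ X p → ⟨ z , X ⊖ dm (p , 0ℤ) ⟩m ≡ ⟨ z , X ⟩m
    pair-⊖dm {z} zH X p = begin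
      ⟨ z , X ⊖ dm (p , 0ℤ) ⟩m
        ≡⟨ pair-⊖ʳ z X (dm (p , 0ℤ)) ⟩
      ⟨ z , X ⟩m - ⟨ z , dm (p , 0ℤ) ⟩m
        ≡⟨ cong (λ x → ⟨ z , X ⟩m - x) (trans (sym (pair-comm _ z)) (dm⊥ℋ¹m p 0ℤ zH)) ⟩
      ⟨ z , X ⟩m - 0ℤ
        ≡⟨ +-identityʳ _ ⟩
      ⟨ z , X ⟩m ∎

    expand : C¹m → C¹m
    expand z = ∑ (proj₁ z) cycleE ⊕² ∑ (proj₂ z) cycleI

    ℋ¹m-expand : ∀ z → Inℋ¹m (expand z)
    ℋ¹m-expand z = ℋ¹m-⊕ (ℋ¹m-∑ (proj₁ z) ℋ¹m-cycleE) (ℋ¹m-∑ (proj₂ z) ℋ¹m-cycleI)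

    -- The e'-coefficient of expand z is the pairing of z with unitE e' ⊖ dm (p , 0ℤ), where p
    -- is the e'-coordinate of the ⋆-paths; the coboundary pairs to zero with the cycle z.
    decompose : ∀ z → Inℋ¹m z → z ≐ expand z
    decompose z zH = edge , leg
      where
      a-[c-b] : ∀ a b c → a - (c - b) ≡ (a + b) - c
      a-[c-b] = solve-∀
      a-[c-0] : ∀ a c → a - (c - 0ℤ) ≡ a - c
      a-[c-0] = solve-∀
      edge : ∀ e' → proj₁ z e' ≡ proj₁ (expand z) e'
      edge e' = begin
        proj₁ z e'                       ≡⟨ sym (pair-unitE z e') ⟩
        ⟨ z , unitE e' ⟩m                ≡⟨ sym (pair-⊖dm zH (unitE e') p) ⟩
        ⟨ z , unitE e' ⊖ dm (p , 0ℤ) ⟩m  ≡⟨ pair-congʳ z (edge-column , leg-column) ⟩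
        ⟨ z , ((λ e → proj₁ (cycleE e) e') , (λ i → proj₁ (cycleI i) e')) ⟩m ∎
        where
        p : V → ℤ
        p v = proj₁ (⋆-path v) e'
        edge-column : ∀ e → δ e' e - (p (t e) - p (o e)) ≡ proj₁ (cycleE e) e'
        edge-column e = trans (a-[c-b] (δ e' e) (p (o e)) (p (t e)))
                              (cong (λ x → (x + p (o e)) - p (t e)) (δ-sym e' e))
        leg-column : ∀ i → 0ℤ - (p (ρ i) - 0ℤ) ≡ proj₁ (cycleI i) e'
        leg-column i = a-[c-0] 0ℤ (p (ρ i))
      leg : ∀ i' → proj₂ z i' ≡ proj₂ (expand z) i'
      leg i' = begin
        proj₂ z i'                       ≡⟨ sym (pair-unitI z i') ⟩
        ⟨ z , unitI i' ⟩m                ≡⟨ sym (pair-⊖dm zH (unitI i') q) ⟩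
        ⟨ z , unitI i' ⊖ dm (q , 0ℤ) ⟩m  ≡⟨ pair-congʳ z (edge-column , leg-column) ⟩
        ⟨ z , ((λ e → proj₂ (cycleE e) i') , (λ i → proj₂ (cycleI i) i')) ⟩m ∎
        where
        q : V → ℤ
        q v = proj₂ (⋆-path v) i'
        edge-column : ∀ e → 0ℤ - (q (t e) - q (o e)) ≡ proj₂ (cycleE e) i'
        edge-column e = a-[c-b] 0ℤ (q (o e)) (q (t e))
        leg-column : ∀ i → δ i' i - (q (ρ i) - 0ℤ) ≡ proj₂ (cycleI i) i'
        leg-column i = trans (a-[c-0] (δ i' i) (q (ρ i))) (cong (_- q (ρ i)) (δ-sym i' i))

    representative : (C¹m → ℤ) → C¹m
    representative h = (λ e → h (cycleE e)) , (λ i → h (cycleI i))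

    module _ {h : C¹m → ℤ} (good : SQ.Good J h) where

      open import Data.Integer using (+_)

      private
        additive : ∀ c c' → Inℋ¹m c → Inℋ¹m c' → h (c ⊕² c') ≡ h c + h c'
        additive = proj₁ good
        congruent : ∀ c c' → Inℋ¹m c → Inℋ¹m c' → proj₁ c ≗ proj₁ c' → proj₂ c ≗ proj₂ c' → h c ≡ h c'
        congruent = proj₂ good

      h-𝟎 : h 𝟎 ≡ 0ℤ
      h-𝟎 = identityˡ-unique (h 𝟎) (h 𝟎)
        (trans (sym (additive 𝟎 𝟎 ℋ¹m-𝟎 ℋ¹m-𝟎))
               (congruent (𝟎 ⊕² 𝟎) 𝟎 (ℋ¹m-⊕ ℋ¹m-𝟎 ℋ¹m-𝟎) ℋ¹m-𝟎 (λ _ → refl) (λ _ → refl)))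

      h-·ℕ : ∀ k {z} → Inℋ¹m z → h (+ k · z) ≡ + k * h z
      h-·ℕ zero {z} zH =
        trans (congruent _ 𝟎 (ℋ¹m-· 0ℤ zH) ℋ¹m-𝟎 (λ _ → refl) (λ _ → refl)) h-𝟎
      h-·ℕ (suc k) {z} zH = begin
        h (+ suc k · z)          ≡⟨ congruent _ _ (ℋ¹m-· (+ suc k) zH) (ℋ¹m-⊕ zH (ℋ¹m-· (+ k) zH))
                                      (λ e → 1+k*x≡x+k*x (+ k) (proj₁ z e))
                                      (λ i → 1+k*x≡x+k*x (+ k) (proj₂ z i)) ⟩
        h (z ⊕² (+ k · z))       ≡⟨ additive z (+ k · z) zH (ℋ¹m-· (+ k) zH) ⟩
        h z + h (+ k · z)        ≡⟨ cong (λ x → h z + x) (h-·ℕ k zH) ⟩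
        h z + + k * h z          ≡⟨ sym (1+k*x≡x+k*x (+ k) (h z)) ⟩
        + suc k * h z            ∎
        where
        1+k*x≡x+k*x : ∀ k x → (1ℤ + k) * x ≡ x + k * x
        1+k*x≡x+k*x = solve-∀

      h-· : ∀ a {z} → Inℋ¹m z → h (a · z) ≡ a * h z
      h-· (+ k)    zH = h-·ℕ k zH
      h-· -[1+ k ] {z} zH = begin
        h (-[1+ k ] · z)          ≡⟨ inverseˡ-unique (h (-[1+ k ] · z)) (h (+ suc k · z)) sum≡0 ⟩
        - h (+ suc k · z)         ≡⟨ cong -_ (h-·ℕ (suc k) zH) ⟩
        - (+ suc k * h z)         ≡⟨ neg-distribˡ-* (+ suc k) (h z) ⟩
        -[1+ k ] * h z            ∎
        where
        -m*x+m*x≡0 : ∀ m x → (- m) * x + m * x ≡ 0ℤ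
        -m*x+m*x≡0 = solve-∀
        sum≡0 : h (-[1+ k ] · z) + h (+ suc k · z) ≡ 0ℤ
        sum≡0 = begin
          h (-[1+ k ] · z) + h (+ suc k · z)
            ≡⟨ sym (additive _ _ (ℋ¹m-· -[1+ k ] zH) (ℋ¹m-· (+ suc k) zH)) ⟩
          h ((-[1+ k ] · z) ⊕² (+ suc k · z))
            ≡⟨ congruent _ 𝟎 (ℋ¹m-⊕ (ℋ¹m-· -[1+ k ] zH) (ℋ¹m-· (+ suc k) zH)) ℋ¹m-𝟎
                 (λ e → -m*x+m*x≡0 (+ suc k) (proj₁ z e))
                 (λ i → -m*x+m*x≡0 (+ suc k) (proj₂ z i)) ⟩
          h 𝟎
            ≡⟨ h-𝟎 ⟩
          0ℤ ∎

      h-∑ : ∀ {n} (a : Fin n → ℤ) {z : Fin n → C¹m} → (∀ j → Inℋ¹m (z j)) →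
        h (∑ a z) ≡ sumFin (λ j → a j * h (z j))
      h-∑ {zero}  a zH = h-𝟎
      h-∑ {suc n} a {z} zH = begin
        h ((a zero · z zero) ⊕² ∑ (a ∘ suc) (z ∘ suc))
          ≡⟨ additive _ _ (ℋ¹m-· (a zero) (zH zero)) (ℋ¹m-∑ (a ∘ suc) (zH ∘ suc)) ⟩
        h (a zero · z zero) + h (∑ (a ∘ suc) (z ∘ suc))
          ≡⟨ cong₂ _+_ (h-· (a zero) (zH zero)) (h-∑ (a ∘ suc) (zH ∘ suc)) ⟩
        a zero * h (z zero) + sumFin (λ j → a (suc j) * h (z (suc j))) ∎

      represents-representative : Represents h (representative h)
      represents-representative = represents λ z zH → begin
        h z
          ≡⟨ congruent z (expand z) zH (ℋ¹m-expand z) (proj₁ (decompose z zH)) (proj₂ (decompose z zH)) ⟩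
        h (expand z)
          ≡⟨ additive _ _ (ℋ¹m-∑ (proj₁ z) ℋ¹m-cycleE) (ℋ¹m-∑ (proj₂ z) ℋ¹m-cycleI) ⟩
        h (∑ (proj₁ z) cycleE) + h (∑ (proj₂ z) cycleI)
          ≡⟨ cong₂ _+_ (h-∑ (proj₁ z) ℋ¹m-cycleE) (h-∑ (proj₂ z) ℋ¹m-cycleI) ⟩
        ⟨ z , representative h ⟩m
          ≡⟨ pair-comm z (representative h) ⟩
        ⟨ representative h , z ⟩m ∎

    -- (F ⊖ F') ⊖ (γ , 0) pairs to zero with every cycle, hence is a coboundary.
    ≈ᴶ⇒≈ᴾ : ∀ {h h' F F'} → Represents h F → Represents h' F' → h ≈ᴶ h' → F ≈ᴾ F'
    ≈ᴶ⇒≈ᴾ {h} {h'} {F} {F'} hF h'F' (γ , ∂γ≡0 , h≡h'+γ) =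
      (potential G , 0ℤ) , γ , ∂γ≡0 ,
      (λ e → trans (x≡[x-y]+y (proj₁ F e - proj₁ F' e) (γ e)) (cong (_+ γ e) (proj₁ G≐dm e))) ,
      (λ i → trans (sym (+-identityʳ _)) (proj₂ G≐dm i))
      where
      G : C¹m
      G = (F ⊖ F') ⊖ (γ , λ _ → 0ℤ)
      cancel : ∀ x y → ((x + y) - x) - y ≡ 0ℤ
      cancel = solve-∀
      G⊥ℋ¹m : ∀ z → Inℋ¹m z → ⟨ G , z ⟩m ≡ 0ℤ
      G⊥ℋ¹m z zH = begin
        ⟨ G , z ⟩m
          ≡⟨ pair-⊖ˡ (F ⊖ F') (γ , λ _ → 0ℤ) z ⟩
        ⟨ F ⊖ F' , z ⟩m - ⟨ (γ , λ _ → 0ℤ) , z ⟩m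
          ≡⟨ cong₂ _-_ (pair-⊖ˡ F F' z) (pair-E γ z) ⟩
        (⟨ F , z ⟩m - ⟨ F' , z ⟩m) - ⟨ proj₁ z , γ ⟩E
          ≡⟨ cong₂ (λ x y → (x - y) - ⟨ proj₁ z , γ ⟩E) (sym (eval hF z zH)) (sym (eval h'F' z zH)) ⟩
        (h z - h' z) - ⟨ proj₁ z , γ ⟩E
          ≡⟨ cong (λ x → (x - h' z) - ⟨ proj₁ z , γ ⟩E) (h≡h'+γ z zH) ⟩
        ((h' z + ⟨ proj₁ z , γ ⟩E) - h' z) - ⟨ proj₁ z , γ ⟩E
          ≡⟨ cancel (h' z) ⟨ proj₁ z , γ ⟩E ⟩
        0ℤ ∎
      G≐dm : G ≐ dm (potential G , 0ℤ)
      G≐dm = ⊥ℋ¹m⇒exact G G⊥ℋ¹m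

    represents-unique : ∀ {h F F'} → Represents h F → Represents h F' → F ≈ᴾ F'
    represents-unique {h} {F} {F'} hF hF' = ≈ᴶ⇒≈ᴾ {F = F} {F'} hF hF' (≈ᴶ-refl h)

    -- When deg x = 0 the legs of ∑ x ⋆-path cancel, leaving a chain of Γ with boundary x.
    lift : (V → ℤ) → E → ℤ
    lift x = proj₁ (∑ x ⋆-path)

    ∂-lift : ∀ x → sumFin x ≡ 0ℤ → ∀ w → ∂ (lift x) w ≡ x w
    ∂-lift x Σx≡0 w = begin
      ∂ (lift x) w
        ≡⟨ sym (+-identityʳ _) ⟩
      ∂ (lift x) w + 0ℤ
        ≡⟨ cong (∂ (lift x) w +_) (sym (push-zero ρ {proj₂ (∑ x ⋆-path)} legs≡0 w)) ⟩
      ∂mV (∑ x ⋆-path) w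
        ≡⟨ ∂mV-∑ x ⋆-path w ⟩
      sumFin (λ v → x v * ∂mV (⋆-path v) w)
        ≡⟨ dot-congʳ x (λ v → trans (∂mV-⋆-path v w) (δ-sym v w)) ⟩
      dot x (δ w)
        ≡⟨ dot-δʳ x w ⟩
      x w ∎
      where
      legs≡0 : ∀ i → sumFin (λ v → x v * δ i₀ i) ≡ 0ℤ
      legs≡0 i = trans (sumFin-*ʳ (δ i₀ i) x) (trans (cong (_* δ i₀ i) Σx≡0) (*-zeroˡ (δ i₀ i)))

    ι-iso : IsIso Cl ClHat ι𝔪
    ι-iso = record
      { pres = λ (x , _) Σx≡0 → lift x , ∂-lift x Σx≡0
      ; resp = λ _ _ _ _ a≈a' → a≈a'
      ; hom  = λ (x , y) (x' , y') _ _ →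
          ≐⇒≈̂ {a = ι𝔪 ((x , y) ⊕ (x' , y'))} ((λ _ → refl) , (λ _ → refl))
      ; inj  = λ _ _ _ _ a≈a' → a≈a'
      ; surj = λ (φ , g) (ω , ∂ω≡φ) →
          (φ , g) , trans (sumFin-cong (sym ∘ ∂ω≡φ)) (sumFin-∂ ω) ,
          ≐⇒≈̂ {a = φ , g} ((λ _ → refl) , (λ _ → refl))
      }
      where open SQ Cl using (_⊕_)

    AJ₀ : SQ.Carrier Cl → SQ.Carrier J
    AJ₀ (x , y) c = ⟨ proj₁ c , lift x ⟩E + ⟨ proj₂ c , y ⟩I

    AJ₀-represents : ∀ x y → Represents (AJ₀ (x , y)) (lift x , y)
    AJ₀-represents x y =
      represents λ (f , g) _ → cong₂ _+_ (dot-comm f (lift x)) (dot-comm g y)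

    AJ₀-isAJ : IsAJ AJ₀
    AJ₀-isAJ x y γ ∂γ≡x = γ' , ∂γ'≡0 , λ (f , g) _ → begin
      dot f (lift x) + dot g y
        ≡⟨ rearrange (dot f (lift x)) (dot g y) (dot f γ) ⟩
      (dot f γ + dot g y) + (dot f (lift x) - dot f γ)
        ≡⟨ cong (dot f γ + dot g y +_) (sym (dot-γ' {f})) ⟩
      (dot f γ + dot g y) + dot f γ' ∎
      where
      rearrange : ∀ a b c → a + b ≡ (c + b) + (a - c)
      rearrange = solve-∀
      Σx≡0 : sumFin x ≡ 0ℤ
      Σx≡0 = trans (sumFin-cong (sym ∘ ∂γ≡x)) (sumFin-∂ γ)
      γ' : E → ℤ
      γ' e = lift x e - γ e
      ∂γ'≡0 : InH₁ γ'
      ∂γ'≡0 v = trans (∂-- (lift x) γ v)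
                      (trans (cong₂ _-_ (∂-lift x Σx≡0 v) (∂γ≡x v)) (+-inverseʳ (x v)))
      dot-γ' : ∀ {f} → dot f γ' ≡ dot f (lift x) - dot f γ
      dot-γ' {f} = trans (dot-comm f γ')
        (trans (dot--ˡ (lift x) γ f) (cong₂ _-_ (dot-comm (lift x) f) (dot-comm γ f)))

    representative-isζ : Isζ representative
    representative-isζ h good z zH = eval (represents-representative good) z (H₁m⇒ℋ¹m z zH)

    module _ (ζ : SQ.Carrier J → SQ.Carrier P) (isζ : Isζ ζ) where

      represents-ζ : ∀ h → SQ.Good J h → Represents h (ζ h)
      represents-ζ h good = represents λ c cH → isζ h good c (ℋ¹m⇒H₁m c cH)

      ζ-hom : ∀ h h' → SQ.Good J h → SQ.Good J h' → ζ (λ c → h c + h' c) ≈ᴾ (ζ h ⊕² ζ h')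
      ζ-hom h h' good good' = represents-unique (represents-ζ _ (represents⇒good sum)) sum
        where
        sum : Represents (λ c → h c + h' c) (ζ h ⊕² ζ h')
        sum = represents-⊕ (represents-ζ h good) (represents-ζ h' good')

      ζ-surj : ∀ F → Σ (C¹m → ℤ) λ h → SQ.Good J h × ζ h ≈ᴾ F
      ζ-surj F = ⟨ F ,_⟩m , good ,
                 represents-unique (represents-ζ ⟨ F ,_⟩m good) (pairing-represents F)
        where
        good : SQ.Good J ⟨ F ,_⟩m
        good = represents⇒good (pairing-represents F)

      ζ-iso : IsIso J P ζ
      ζ-iso = record
        { pres = λ _ _ → tt
        ; resp = λ h h' good good' → ≈ᴶ⇒≈ᴾ (represents-ζ h good) (represents-ζ h' good')
        ; hom  = ζ-hom
        ; inj  = λ h h' good good' → ≈ᴾ⇒≈ᴶ (represents-ζ h good) (represents-ζ h' good')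
        ; surj = λ F _ → ζ-surj F
        }

    module _ (AJ : SQ.Carrier Cl → SQ.Carrier J) (isAJ : IsAJ AJ) where

      -- Every property of AJ is transported from χ through this cochain.
      AJ-represented : ∀ a → SQ.Good Cl a → Σ C¹m λ F → Represents (AJ a) F × χ𝔪 F ≐ ι𝔪 a
      AJ-represented (x , y) Σx≡0 =
        (lift x , y) ⊕² (γ , λ _ → 0ℤ) , represents-≈ᴶ AJa≈AJ₀a (AJ₀-represents x y) , χ≐ι
        where
        AJa≈AJ₀a : AJ (x , y) ≈ᴶ AJ₀ (x , y)
        AJa≈AJ₀a = isAJ x y (lift x) (∂-lift x Σx≡0)
        γ : E → ℤ
        γ = proj₁ AJa≈AJ₀a
        χ≐ι : χ𝔪 ((lift x , y) ⊕² (γ , λ _ → 0ℤ)) ≐ (x , y)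
        χ≐ι = (λ v → begin
                 ∂ (λ e → lift x e + γ e) v  ≡⟨ ∂-+ (lift x) γ v ⟩
                 ∂ (lift x) v + ∂ γ v        ≡⟨ cong₂ _+_ (∂-lift x Σx≡0 v) (proj₁ (proj₂ AJa≈AJ₀a) v) ⟩
                 x v + 0ℤ                    ≡⟨ +-identityʳ (x v) ⟩
                 x v                         ∎) ,
              (λ i → +-identityʳ (y i))

      module _ (a : SQ.Carrier Cl) (good : SQ.Good Cl a) where

        repAJ : C¹m
        repAJ = proj₁ (AJ-represented a good)

        represents-repAJ : Represents (AJ a) repAJ
        represents-repAJ = proj₁ (proj₂ (AJ-represented a good))

        χ-repAJ : χ𝔪 repAJ ≐ ι𝔪 a
        χ-repAJ = proj₂ (proj₂ (AJ-represented a good))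

      AJ-hom : ∀ a a' (good : SQ.Good Cl a) (good' : SQ.Good Cl a') →
        AJ (SQ._⊕_ Cl a a') ≈ᴶ (λ c → AJ a c + AJ a' c)
      AJ-hom a@(x , y) a'@(x' , y') good good' =
        ≈ᴾ⇒≈ᴶ (represents-repAJ a⊕a' good⊕)
              (represents-⊕ (represents-repAJ a good) (represents-repAJ a' good'))
              (χ-inj (repAJ a⊕a' good⊕) (repAJ a good ⊕² repAJ a' good')
                 (≐⇒≈̂ (≐-trans (χ-repAJ a⊕a' good⊕) (≐-sym χ-sum))))
        where
        a⊕a' : SQ.Carrier Cl
        a⊕a' = SQ._⊕_ Cl a a'
        good⊕ : SQ.Good Cl a⊕a'
        good⊕ = trans (sumFin-+ x x') (cong₂ _+_ good good')
        χ-sum : χ𝔪 (repAJ a good ⊕² repAJ a' good') ≐ a⊕a'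
        χ-sum =
          (λ v → trans (∂-+ (proj₁ (repAJ a good)) (proj₁ (repAJ a' good')) v)
                       (cong₂ _+_ (proj₁ (χ-repAJ a good) v) (proj₁ (χ-repAJ a' good') v))) ,
          (λ i → cong₂ _+_ (proj₂ (χ-repAJ a good) i) (proj₂ (χ-repAJ a' good') i))

      AJ-resp : ∀ a a' (good : SQ.Good Cl a) (good' : SQ.Good Cl a') →
        SQ._≈_ Cl a a' → AJ a ≈ᴶ AJ a'
      AJ-resp a a' good good' a≈a' =
        ≈ᴾ⇒≈ᴶ (represents-repAJ a good) (represents-repAJ a' good')
          (χ-inj (repAJ a good) (repAJ a' good')
            (≈̂-respˡ-≐ (≐-sym (χ-repAJ a good))
              (≈̂-respʳ-≐ {a = ι𝔪 a} (≐-sym (χ-repAJ a' good')) a≈a')))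

      AJ-inj : ∀ a a' (good : SQ.Good Cl a) (good' : SQ.Good Cl a') →
        AJ a ≈ᴶ AJ a' → SQ._≈_ Cl a a'
      AJ-inj a a' good good' AJa≈AJa' =
        ≈̂-respˡ-≐ (χ-repAJ a good)
          (≈̂-respʳ-≐ {a = χ𝔪 (repAJ a good)} (χ-repAJ a' good')
            (χ-resp (repAJ a good) (repAJ a' good')
              (≈ᴶ⇒≈ᴾ (represents-repAJ a good) (represents-repAJ a' good') AJa≈AJa')))

      AJ-surj : ∀ h → SQ.Good J h → Σ (SQ.Carrier Cl) λ a → SQ.Good Cl a × AJ a ≈ᴶ h
      AJ-surj h good =
        a , good-a ,
        ≈ᴾ⇒≈ᴶ (represents-repAJ a good-a) (represents-representative good)
              (χ-inj (repAJ a good-a) (representative h) (≐⇒≈̂ (χ-repAJ a good-a)))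
        where
        a : SQ.Carrier Cl
        a = χ𝔪 (representative h)
        good-a : SQ.Good Cl a
        good-a = sumFin-∂ (proj₁ (representative h))

      AJ-iso : IsIso Cl J AJ
      AJ-iso = record
        { pres = λ a good → represents⇒good (represents-repAJ a good)
        ; resp = AJ-resp
        ; hom  = AJ-hom
        ; inj  = AJ-inj
        ; surj = AJ-surj
        }

    commutes : ∀ AJ ζ → IsAJ AJ → Isζ ζ →
      ∀ a → SQ.Good Cl a → χ𝔪 (ζ (AJ a)) ≈̂ ι𝔪 a
    commutes AJ ζ isAJ isζ a good =
      ≈̂-respʳ-≐ {a = χ𝔪 (ζ (AJ a))} (χ-repAJ AJ isAJ a good)
        (χ-resp (ζ (AJ a)) (repAJ AJ isAJ a good)
          (represents-unique (represents-ζ ζ isζ (AJ a) (IsIso.pres (AJ-iso AJ isAJ) a good))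
                             (represents-repAJ AJ isAJ a good)))

theorem3p4p5 : (Γ : Graph) (μ : Modulus Γ) →
    0 < Graph.nV Γ → 0 < Modulus.nI μ → Connected Γ →
    let open Constructions Γ μ in
      IsIso Cl ClHat ι𝔪
      × IsIso P ClHat χ𝔪
      × Σ (SQ.Carrier Cl → SQ.Carrier J) IsAJ
      × Σ (SQ.Carrier J → SQ.Carrier P) Isζ
      × (∀ AJ ζ → IsAJ AJ → Isζ ζ →
           IsIso Cl J AJ × IsIso J P ζ
           × (∀ a → SQ.Good Cl a → SQ._≈_ ClHat (χ𝔪 (ζ (AJ a))) (ι𝔪 a)))
-- The hypothesis 0 < nV is implied by 0 < nI.
theorem3p4p5 Γ μ _ 0<nI conn =
  ι-iso , χ-iso , (AJ₀ , AJ₀-isAJ) , (representative , representative-isζ) ,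
  λ AJ ζ isAJ isζ → AJ-iso AJ isAJ , ζ-iso ζ isζ , commutes AJ ζ isAJ isζ
  where
  open ExtendedGraph Γ μ
  open Rooted conn (fromℕ< 0<nI)
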